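{- $\ell(4) = 360$. That is, there is a covering system consisting of one congruence for each divisor $d$ of $360$ with $d \ge 4$ (the divisor $d$ being its modulus), and for every positive integer $m < 360$ there is no covering system consisting of one congruence for each divisor $d$ of $m$ with $d \ge 4$.
   Context: A covering system (covering) is a finite set of congruences $\{x \equiv r_i \pmod{n_i}\}$ with positive integer moduli such that every integer satisfies at least one of them. For an integer $n\ge 2$, $\ell(n)$ denotes the least positive integer such that there exists a covering whose moduli are exactly the divisors of $\ell(n)$ which are at least $n$, each used once. -}

module Defs where

open import Data.Nat using (ℕ; _≤_; _<_)
open import Data.Nat.Divisibility using (_∣_)
open import Data.Integer using (ℤ; +_; _-_)
import Data.Integer.Divisibility as ℤD
open import Data.Product using (Σ; ∃; ∃-syntax; _×_)
open import Relation.Nullary using (¬_)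

_≡_[mod_] : ℤ → ℤ → ℕ → Set
x ≡ a [mod d ] = (+ d) ℤD.∣ (x - a)

ResidueChoice : ℕ → ℕ → Set
ResidueChoice n m = (d : ℕ) → d ∣ m → n ≤ d → ℤ

Covers : (n m : ℕ) → ResidueChoice n m → Set
Covers n m r = (x : ℤ) → ∃[ d ] Σ (d ∣ m) λ d∣m → Σ (n ≤ d) λ n≤d → x ≡ r d d∣m n≤d [mod d ]

HasDivisorCovering : ℕ → ℕ → Set
HasDivisorCovering n m = Σ (ResidueChoice n m) (Covers n m)

IsEll : ℕ → ℕ → Set
IsEll n L = (0 < L) × HasDivisorCovering n L × ((m : ℕ) → 0 < m → m < L → ¬ HasDivisorCovering n m)

-- The covering for 360 is exhibited and checked on one period. For m < 360 an exhaustive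
-- search rules out every covering. Fix k and q and split 0, …, kq − 1 into the k fibres
-- F_t = {t + jk : j < q}. If g divides both d and k, a congruence x ≡ σ (mod d) meets F_t only
-- when t ≡ σ (mod g), and then in at most c_d points, c_d being the largest number of points of
-- one fibre lying in a single class mod d. Hence a covering yields, for every modulus d in turn,
-- a class mod g whose fibres lose c_d points of their demand (the number of points not yet
-- covered), such that all demand is eventually met; and at each stage the total demand is at most
-- what the remaining moduli can still supply. The search explores all such choices and finds
-- none. Translating the covering so that one chosen congruence has residue 0 removes a symmetry.
module Submission where

open import Defs

open import Data.Bool using (Bool; true; false; if_then_else_; _∧_; _∨_; T)
open import Data.Bool.ListAction using (any; all)
open import Data.Bool.Properties using (T-∧; T-∨)
open import Data.Empty using (⊥-elim)
open import Data.Integer as ℤ using (ℤ; _⊖_; _%ℕ_; _/ℕ_) renaming (_+_ to _+ℤ_; _-_ to _-ℤ_; _*_ to _*ℤ_)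
import Data.Integer.Properties as ℤ
open import Data.Integer.DivMod using (n%ℕd<d; a≡a%ℕn+[a/ℕn]*n)
import Data.Integer.Divisibility.Signed as ℤ∣
open import Data.Integer.Solver using () renaming (module +-*-Solver to ℤ-Solver)
open import Data.Nat.Solver using () renaming (module +-*-Solver to ℕ-Solver)
open import Data.List using (List; []; _∷_; _++_; map; replicate; take; drop; length; foldr; upTo; applyUpTo; filter)
open import Data.List.Membership.Propositional using (_∈_; lose; find)
open import Data.List.Membership.Propositional.Properties using (∈-filter⁺; ∈-filter⁻; ∈-upTo⁺; ∈-applyUpTo⁺; ∈-map⁺)
open import Data.List.Properties using (map-cong; map-cong-local; length-map; length-upTo; length-take; length-drop; length-replicate; take++drop≡id)
open import Data.List.Relation.Unary.All as All using (All; []; _∷_)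
open import Data.List.Relation.Unary.All.Properties using (all⁺; map⁺)
open import Data.List.Relation.Unary.Any using (Any; here; there)
open import Data.List.Relation.Unary.Any.Properties using (any⁺; any⁻)
open import Data.Maybe using (Maybe; just; nothing)
open import Data.Nat using (ℕ; zero; suc; _+_; _*_; _∸_; _⊓_; _⊔_; _%_; _≡ᵇ_; _≤ᵇ_; _≤_; _<_; _≤?_; _<?_; z≤n; s≤s; z<s; NonZero; >-nonZero)
open import Data.Nat.Divisibility using (_∣_; divides; _∣?_; _∣0; ∣-trans; 0∣⇒≡0; ∣⇒≤)
open import Data.Nat.DivMod using (m<n⇒m%n≡m; [m+n]%n≡m%n; [m+kn]%n≡m%n; %-remove-+ʳ; m∣n⇒o%n%m≡o%m; m%n<n)
open import Data.Nat.GCD using (gcd; gcd[m,n]∣m; gcd[m,n]∣n; gcd[m,n]≢0)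
open import Data.Nat.ListAction using (sum)
open import Data.Nat.Properties
open import Data.Product using (_×_; _,_; proj₁; proj₂; ∃-syntax)
open import Data.Sum using (_⊎_; inj₁; inj₂)
open import Data.Unit using (tt)
open import Function using (_∘_; Equivalence)
open import Relation.Nullary using (¬_; Dec; yes; no; contradiction)
open import Relation.Nullary.Decidable using (_×-dec_; ¬?)
open import Relation.Binary.PropositionalEquality using (_≡_; refl; sym; trans; cong; cong₂; subst; module ≡-Reasoning)

private
  variable
    A B I : Set

countᵇ : (A → Bool) → List A → ℕ
countᵇ p []       = 0
countᵇ p (x ∷ xs) = if p x then suc (countᵇ p xs) else countᵇ p xs

countᵇ-∨ : ∀ (p q : A → Bool) xs → countᵇ (λ x → p x ∨ q x) xs ≤ countᵇ p xs + countᵇ q xs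
countᵇ-∨ p q [] = z≤n
countᵇ-∨ p q (x ∷ xs) with p x | q x
... | true  | true  = s≤s (≤-trans (countᵇ-∨ p q xs) (+-monoʳ-≤ (countᵇ p xs) (n≤1+n _)))
... | true  | false = s≤s (countᵇ-∨ p q xs)
... | false | true  = ≤-trans (s≤s (countᵇ-∨ p q xs)) (≤-reflexive (sym (+-suc _ _)))
... | false | false = countᵇ-∨ p q xs

countᵇ-map : ∀ (p : B → Bool) (f : A → B) xs → countᵇ p (map f xs) ≡ countᵇ (p ∘ f) xs
countᵇ-map p f [] = refl
countᵇ-map p f (x ∷ xs) with p (f x)
... | true  = cong suc (countᵇ-map p f xs)
... | false = countᵇ-map p f xs

countᵇ-none : ∀ (p : A → Bool) xs → (∀ x → ¬ T (p x)) → countᵇ p xs ≡ 0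
countᵇ-none p [] _ = refl
countᵇ-none p (x ∷ xs) h with p x | h x
... | true  | ¬px = ⊥-elim (¬px tt)
... | false | _   = countᵇ-none p xs h

countᵇ-all : ∀ (p : A → Bool) xs → (∀ x → T (p x)) → countᵇ p xs ≡ length xs
countᵇ-all p [] _ = refl
countᵇ-all p (x ∷ xs) h with p x | h x
... | true | _ = cong suc (countᵇ-all p xs h)

countᵇ-pos : ∀ (p : A → Bool) xs → 0 < countᵇ p xs → ∃[ x ] x ∈ xs × T (p x)
countᵇ-pos p (x ∷ xs) pos with p x in eq
... | true  = x , here refl , subst T (sym eq) tt
... | false = let y , y∈xs , py = countᵇ-pos p xs pos in y , there y∈xs , py

any≡false⇒¬T : ∀ (p : A → Bool) {xs x} → any p xs ≡ false → x ∈ xs → ¬ T (p x)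
any≡false⇒¬T p none x∈xs px = subst T none (any⁺ p (lose x∈xs px))

maximum : List ℕ → ℕ
maximum = foldr _⊔_ 0

-- Entry i of a list, with value 0 past its end.
infixl 9 _!_
_!_ : List ℕ → ℕ → ℕ
[]       ! _     = 0
(x ∷ xs) ! zero  = x
(x ∷ xs) ! suc i = xs ! i

!≤maximum : ∀ xs i → xs ! i ≤ maximum xs
!≤maximum []       i       = z≤n
!≤maximum (x ∷ xs) zero    = m≤m⊔n x (maximum xs)
!≤maximum (x ∷ xs) (suc i) = ≤-trans (!≤maximum xs i) (m≤n⊔m x (maximum xs))

∈⇒≤maximum : ∀ (f : A → ℕ) {xs y} → y ∈ xs → f y ≤ maximum (map f xs)
∈⇒≤maximum f {x ∷ _}  (here refl) = m≤m⊔n (f x) _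
∈⇒≤maximum f {x ∷ xs} (there y∈xs) = ≤-trans (∈⇒≤maximum f y∈xs) (m≤n⊔m (f x) _)

!-beyond : ∀ xs {i} → length xs ≤ i → xs ! i ≡ 0
!-beyond []       _         = refl
!-beyond (x ∷ xs) (s≤s len) = !-beyond xs len

!-replicate≤ : ∀ k (q : ℕ) i → replicate k q ! i ≤ q
!-replicate≤ zero    q i       = z≤n
!-replicate≤ (suc k) q zero    = ≤-refl
!-replicate≤ (suc k) q (suc i) = !-replicate≤ k q i

sum≡0 : ∀ xs → (∀ i → xs ! i ≤ 0) → sum xs ≡ 0
sum≡0 []       _ = refl
sum≡0 (x ∷ xs) h rewrite n≤0⇒n≡0 (h 0) = sum≡0 xs (h ∘ suc)

sum-map-+ : ∀ (f g : A → ℕ) xs → sum (map (λ x → f x + g x) xs) ≡ sum (map f xs) + sum (map g xs)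
sum-map-+ f g []       = refl
sum-map-+ f g (x ∷ xs) rewrite sum-map-+ f g xs = ℕ-Solver.solve 4
  (λ a b c d → (a :+ b) :+ (c :+ d) := (a :+ c) :+ (b :+ d)) refl (f x) (g x) (sum (map f xs)) (sum (map g xs))
  where open ℕ-Solver

sum-map-mono : ∀ {f g : A → ℕ} {xs} → All (λ x → f x ≤ g x) xs → sum (map f xs) ≤ sum (map g xs)
sum-map-mono []         = z≤n
sum-map-mono (fx≤gx ∷ h) = +-mono-≤ fx≤gx (sum-map-mono h)

≤-sum⇒≤-sum-⊓ : ∀ (w : A → ℕ) xs {a} → a ≤ sum (map w xs) → a ≤ sum (map (λ x → a ⊓ w x) xs)
≤-sum⇒≤-sum-⊓ w []       a≤ = a≤
≤-sum⇒≤-sum-⊓ w (x ∷ xs) {a} a≤ with a ≤? w x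
... | yes a≤wx rewrite m≤n⇒m⊓n≡m a≤wx = m≤m+n a _
... | no  a≰wx = begin
  a                                          ≡⟨ m+[n∸m]≡n wx≤a ⟨
  w x + (a ∸ w x)                            ≤⟨ +-monoʳ-≤ (w x) rest ⟩
  w x + sum (map (λ y → a ⊓ w y) xs)         ≡⟨ cong (_+ _) (m≥n⇒m⊓n≡n wx≤a) ⟨
  a ⊓ w x + sum (map (λ y → a ⊓ w y) xs)     ∎
  where
  open ≤-Reasoning
  wx≤a = <⇒≤ (≰⇒> a≰wx)
  rest : a ∸ w x ≤ sum (map (λ y → a ⊓ w y) xs)
  rest = ≤-trans (≤-sum⇒≤-sum-⊓ w xs (m≤n+o⇒m∸n≤o a (w x) a≤))
                 (sum-map-mono (All.universal (λ y → ⊓-monoˡ-≤ (w y) (m∸n≤m a (w x))) xs))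

selectSum : (ℕ → Bool) → List ℕ → ℕ
selectSum P []       = 0
selectSum P (x ∷ xs) = (if P 0 then x else 0) + selectSum (P ∘ suc) xs

selectSum-++ : ∀ P xs ys → selectSum P (xs ++ ys) ≡ selectSum P xs + selectSum (λ i → P (length xs + i)) ys
selectSum-++ P []       ys = refl
selectSum-++ P (x ∷ xs) ys =
  trans (cong ((if P 0 then x else 0) +_) (selectSum-++ (P ∘ suc) xs ys))
        (sym (+-assoc (if P 0 then x else 0) (selectSum (P ∘ suc) xs) _))

selectSum-cong : ∀ {P Q} xs → (∀ {i} → i < length xs → P i ≡ Q i) → selectSum P xs ≡ selectSum Q xs
selectSum-cong []       _ = refl
selectSum-cong (x ∷ xs) h =
  cong₂ (λ b s → (if b then x else 0) + s) (h z<s) (selectSum-cong xs (h ∘ s≤s))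

selectSum-none : ∀ xs → selectSum (λ _ → false) xs ≡ 0
selectSum-none []       = refl
selectSum-none (x ∷ xs) = selectSum-none xs

selectSum-≡ᵇ : ∀ xs r → selectSum (_≡ᵇ r) xs ≡ xs ! r
selectSum-≡ᵇ []       r       = refl
selectSum-≡ᵇ (x ∷ xs) zero    = trans (cong (x +_) (selectSum-none xs)) (+-identityʳ x)
selectSum-≡ᵇ (x ∷ xs) (suc r) = selectSum-≡ᵇ xs r

-- Pointwise, a ≤ Σᵢ wᵢ gives a ≤ Σᵢ (a ⊓ wᵢ); summing over the positions exchanges the two sums.
sum≤sum-selectSum : ∀ (P : I → ℕ → Bool) (c : I → ℕ) is xs →
  (∀ {t} → t < length xs → xs ! t ≤ sum (map (λ i → if P i t then c i else 0) is)) →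
  sum xs ≤ sum (map (λ i → selectSum (P i) (map (_⊓ c i) xs)) is)
sum≤sum-selectSum P c is []       _ = z≤n
sum≤sum-selectSum P c is (x ∷ xs) h = begin
  x + sum xs
    ≤⟨ +-mono-≤ first (sum≤sum-selectSum (λ i t → P i (suc t)) c is xs (h ∘ s≤s)) ⟩
  sum (map (λ i → if P i 0 then x ⊓ c i else 0) is) + sum (map (λ i → selectSum (P i ∘ suc) (map (_⊓ c i) xs)) is)
    ≡⟨ sum-map-+ (λ i → if P i 0 then x ⊓ c i else 0) (λ i → selectSum (P i ∘ suc) (map (_⊓ c i) xs)) is ⟨
  sum (map (λ i → selectSum (P i) (map (_⊓ c i) (x ∷ xs))) is) ∎
  where
  open ≤-Reasoning
  ⊓-if : ∀ i → x ⊓ (if P i 0 then c i else 0) ≡ (if P i 0 then x ⊓ c i else 0)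
  ⊓-if i with P i 0
  ... | true  = refl
  ... | false = ⊓-zeroʳ x
  first : x ≤ sum (map (λ i → if P i 0 then x ⊓ c i else 0) is)
  first = subst (x ≤_) (cong sum (map-cong ⊓-if is))
                (≤-sum⇒≤-sum-⊓ (λ i → if P i 0 then c i else 0) is (h z<s))

-- Agrees with _%_ on nonzero moduli and puts x %′ 0 = x, so that computations need no
-- NonZero instances.
infixl 7 _%′_
_%′_ : ℕ → ℕ → ℕ
x %′ zero  = x
x %′ suc d = x % suc d

0%′≡0 : ∀ g → 0 %′ g ≡ 0
0%′≡0 zero    = refl
0%′≡0 (suc g) = refl

%′<period : ∀ {g} x → 0 < g → x %′ g < g
%′<period {suc g} x _ = m%n<n x (suc g)

%′-small : ∀ {g i} → i < g → i %′ g ≡ i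
%′-small {suc g} i<g = m<n⇒m%n≡m i<g

%′-+period : ∀ g i → (g + i) %′ g ≡ i %′ g
%′-+period zero    i = refl
%′-+period (suc g) i = trans (cong (_% suc g) (+-comm (suc g) i)) ([m+n]%n≡m%n i (suc g))

%′-%′-∣ : ∀ {g d} x → g ∣ d → x %′ d %′ g ≡ x %′ g
%′-%′-∣ {g}     {zero}  x _   = refl
%′-%′-∣ {zero}  {suc d} x 0∣d = contradiction (0∣⇒≡0 0∣d) λ ()
%′-%′-∣ {suc g} {suc d} x g∣d = m∣n⇒o%n%m≡o%m (suc g) (suc d) x g∣d

%′-+-*-∣ : ∀ {g k} t j → g ∣ k → (t + j * k) %′ g ≡ t %′ g
%′-+-*-∣ {zero}  {k} t j 0∣k rewrite 0∣⇒≡0 0∣k | *-zeroʳ j | +-identityʳ t = refl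
%′-+-*-∣ {suc g} {k} t j (divides q refl) =
  trans (cong (λ z → (t + z) % suc g) (sym (*-assoc j q (suc g)))) ([m+kn]%n≡m%n t (j * q) (suc g))

zipAdd : List ℕ → List ℕ → List ℕ
zipAdd []       ys       = ys
zipAdd (x ∷ xs) []       = x ∷ xs
zipAdd (x ∷ xs) (y ∷ ys) = x + y ∷ zipAdd xs ys

zipAdd-! : ∀ xs ys i → zipAdd xs ys ! i ≡ xs ! i + ys ! i
zipAdd-! []       ys       i       = refl
zipAdd-! (x ∷ xs) []       i       = sym (+-identityʳ _)
zipAdd-! (x ∷ xs) (y ∷ ys) zero    = refl
zipAdd-! (x ∷ xs) (y ∷ ys) (suc i) = zipAdd-! xs ys i

-- The fuel length xs suffices since each round consumes g ≥ 1 entries.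
chunkSumFuel : ℕ → ℕ → List ℕ → List ℕ
chunkSumFuel zero    g xs = []
chunkSumFuel (suc f) g xs = zipAdd (take g xs) (chunkSumFuel f g (drop g xs))

chunkSum : ℕ → List ℕ → List ℕ
chunkSum g xs = chunkSumFuel (length xs) g xs

take-full-or-drop-empty : ∀ g (xs : List A) → length (take g xs) ≡ g ⊎ drop g xs ≡ []
take-full-or-drop-empty zero    xs       = inj₁ refl
take-full-or-drop-empty (suc g) []       = inj₂ refl
take-full-or-drop-empty (suc g) (x ∷ xs) with take-full-or-drop-empty g xs
... | inj₁ full  = inj₁ (cong suc full)
... | inj₂ empty = inj₂ empty

chunkSumFuel-! : ∀ {g r} → r < g → ∀ f xs → length xs ≤ f →
                 chunkSumFuel f g xs ! r ≡ selectSum (λ i → i %′ g ≡ᵇ r) xs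
chunkSumFuel-! r<g zero    []       _   = refl
chunkSumFuel-! {g} {r} r<g (suc f) xs len≤ = begin
  chunkSumFuel (suc f) g xs ! r
    ≡⟨ zipAdd-! (take g xs) _ r ⟩
  take g xs ! r + chunkSumFuel f g (drop g xs) ! r
    ≡⟨ cong₂ _+_ (sym (selectSum-≡ᵇ (take g xs) r)) (chunkSumFuel-! r<g f (drop g xs) drop≤) ⟩
  selectSum (_≡ᵇ r) (take g xs) + selectSum R (drop g xs)
    ≡⟨ cong₂ _+_ (selectSum-cong (take g xs) first-chunk) (selectSum-cong (drop g xs) later-chunks) ⟩
  selectSum R (take g xs) + selectSum (λ i → R (length (take g xs) + i)) (drop g xs)
    ≡⟨ selectSum-++ R (take g xs) (drop g xs) ⟨
  selectSum R (take g xs ++ drop g xs)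
    ≡⟨ cong (selectSum R) (take++drop≡id g xs) ⟩
  selectSum R xs ∎
  where
  open ≡-Reasoning
  R = λ i → i %′ g ≡ᵇ r
  drop≤ : length (drop g xs) ≤ f
  drop≤ = subst (_≤ f) (sym (length-drop g xs)) (∸-mono len≤ (≤-trans (s≤s z≤n) r<g))
  first-chunk : ∀ {i} → i < length (take g xs) → (i ≡ᵇ r) ≡ R i
  first-chunk {i} i< = cong (_≡ᵇ r) (sym (%′-small (<-≤-trans i< (subst (_≤ g) (sym (length-take g xs)) (m⊓n≤m g _)))))
  later-chunks : ∀ {i} → i < length (drop g xs) → R i ≡ R (length (take g xs) + i)
  later-chunks {i} i< with take-full-or-drop-empty g xs
  ... | inj₁ full  rewrite full = cong (_≡ᵇ r) (sym (%′-+period g i))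
  ... | inj₂ empty rewrite empty with () ← i<

chunkSum-! : ∀ {g r} → r < g → ∀ xs → chunkSum g xs ! r ≡ selectSum (λ i → i %′ g ≡ᵇ r) xs
chunkSum-! r<g xs = chunkSumFuel-! r<g (length xs) xs ≤-refl

-- The search

modulus? : ∀ n m d → Dec (n ≤ d × d ∣ m)
modulus? n m d = n ≤? d ×-dec d ∣? m

divisorsFrom : ℕ → ℕ → List ℕ
divisorsFrom n m = filter (modulus? n m) (upTo (suc m))

fibre : (k q t : ℕ) → List ℕ
fibre k q t = map (λ j → t + j * k) (upTo q)

multiplicity : List ℕ → ℕ
multiplicity xs = maximum (map (λ y → countᵇ (_≡ᵇ y) xs) xs)

record Profile : Set where
  constructor profile
  field
    modulus period capacity : ℕ

open Profile

profileOf : (k q d : ℕ) → Profile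
profileOf k q d =
  profile d (gcd d k) (maximum (map (λ t → multiplicity (map (_%′ d) (fibre k q t))) (upTo k)))

-- How much the congruence of profile p, with residue ≡ r (mod period p), removes from the demand
-- of fibre t.
reach : Profile → ℕ → ℕ → ℕ
reach p r t = if t %′ period p ≡ᵇ r then capacity p else 0

lowerFrom : Profile → ℕ → ℕ → List ℕ → List ℕ
lowerFrom p r t []         = []
lowerFrom p r t (x ∷ dem) = x ∸ reach p r t ∷ lowerFrom p r (suc t) dem

lower : Profile → ℕ → List ℕ → List ℕ
lower p r = lowerFrom p r 0

lower-! : ∀ p r dem t → lower p r dem ! t ≡ dem ! t ∸ reach p r t
lower-! p r dem t = go 0 dem t
  where
  go : ∀ s dem t → lowerFrom p r s dem ! t ≡ dem ! t ∸ reach p r (s + t)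
  go s []        t       = sym (0∸n≡0 (reach p r (s + t)))
  go s (x ∷ dem) zero    = cong (λ u → x ∸ reach p r u) (sym (+-identityʳ s))
  go s (x ∷ dem) (suc t) = trans (go (suc s) dem t) (cong (λ u → dem ! t ∸ reach p r u) (sym (+-suc s t)))

length-lower : ∀ p r dem → length (lower p r dem) ≡ length dem
length-lower p r = go 0
  where
  go : ∀ s dem → length (lowerFrom p r s dem) ≡ length dem
  go s []        = refl
  go s (x ∷ dem) = cong suc (go (suc s) dem)

-- Entry r bounds the demand met by a congruence of profile p with residue ≡ r (mod period p).
gains : Profile → List ℕ → List ℕ
gains p dem = chunkSum (period p) (map (_⊓ capacity p) dem)

potential : List Profile → List ℕ → ℕ
potential ps dem = sum (map (λ p → maximum (gains p dem)) ps)

-- A with, unlike a let, shares these three values between the branches.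
search : List Profile → List ℕ → Bool
search []       dem = sum dem ≡ᵇ 0
search (p ∷ ps) dem with sum dem | potential ps dem | gains p dem
... | total | rest | G =
  (total ≡ᵇ 0) ∨ any (λ r → (total ≤ᵇ G ! r + rest) ∧ search ps (lower p r dem)) (upTo (period p))

plainSearch : (n m k q : ℕ) → Bool
plainSearch n m k q = search (map (profileOf k q) (divisorsFrom n m)) (replicate k q)

pinnedSearch : (n m k q d₀ : ℕ) → Bool
pinnedSearch n m k q d₀ =
  search (map (profileOf k q) (filter (λ d → ¬? (d ≟ d₀)) (divisorsFrom n m)))
         (lower (profileOf k q d₀) 0 (replicate k q))

record Strategy : Set where
  constructor strategy
  field
    fibres fibreLength : ℕ
    pinned             : Maybe ℕ

-- Pinning d₀ gives its congruence residue 0, as a translation of any covering achieves; a pin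
-- that is not a modulus of the system decides nothing.
feasible : ℕ → ℕ → Strategy → Bool
feasible n m (strategy k q nothing)   = plainSearch n m k q
feasible n m (strategy k q (just d₀)) with modulus? n m d₀
... | no  _ = true
... | yes _ = pinnedSearch n m k q d₀

-- Completeness of the search

record Admissible (k q : ℕ) (p : Profile) : Set where
  field
    period>0        : 0 < period p
    period∣modulus  : period p ∣ modulus p
    period∣fibres   : period p ∣ k
    fibre-classes≤capacity : ∀ {t} → t < k → ∀ s →
                             countᵇ (λ x → x %′ modulus p ≡ᵇ s) (fibre k q t) ≤ capacity p

open Admissible

countᵇ≤multiplicity : ∀ xs s → countᵇ (_≡ᵇ s) xs ≤ multiplicity xs
countᵇ≤multiplicity xs s with countᵇ (_≡ᵇ s) xs in eq
... | zero  = z≤n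
... | suc _ with countᵇ-pos (_≡ᵇ s) xs (subst (0 <_) (sym eq) z<s)
...   | y , y∈xs , y≡ᵇs with refl ← ≡ᵇ⇒≡ y s y≡ᵇs =
  subst (_≤ multiplicity xs) eq (∈⇒≤maximum (λ y → countᵇ (_≡ᵇ y) xs) y∈xs)

profileOf-admissible : ∀ {k q d} → 0 < d → Admissible k q (profileOf k q d)
profileOf-admissible {k} {q} {d} d>0 = record
  { period>0       = n≢0⇒n>0 (gcd[m,n]≢0 d k (inj₁ (>⇒≢ d>0)))
  ; period∣modulus = gcd[m,n]∣m d k
  ; period∣fibres  = gcd[m,n]∣n d k
  ; fibre-classes≤capacity = λ {t} t<k s → begin
      countᵇ (λ x → x %′ d ≡ᵇ s) (fibre k q t)  ≡⟨ countᵇ-map (_≡ᵇ s) (_%′ d) (fibre k q t) ⟨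
      countᵇ (_≡ᵇ s) (classes t)               ≤⟨ countᵇ≤multiplicity (classes t) s ⟩
      multiplicity (classes t)                 ≤⟨ ∈⇒≤maximum (multiplicity ∘ classes) (∈-upTo⁺ t<k) ⟩
      capacity (profileOf k q d)               ∎
  }
  where
  open ≤-Reasoning
  classes = λ t → map (_%′ d) (fibre k q t)

module Completeness (k q : ℕ) (σ : ℕ → ℕ) where

  covers : Profile → ℕ → Bool
  covers p x = x %′ modulus p ≡ᵇ σ (modulus p)

  coveredIn : List Profile → ℕ → ℕ
  coveredIn ps t = countᵇ (λ x → any (λ p → covers p x) ps) (fibre k q t)

  residue : Profile → ℕ
  residue p = σ (modulus p) %′ period p

  Dominated : List Profile → List ℕ → Set
  Dominated ps dem = ∀ t → dem ! t ≤ coveredIn ps t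

  covered≤reach : ∀ {p t} → Admissible k q p → t < k → countᵇ (covers p) (fibre k q t) ≤ reach p (residue p) t
  covered≤reach {p} {t} adm t<k with t %′ period p ≡ᵇ residue p in eq
  ... | true  = fibre-classes≤capacity adm t<k (σ (modulus p))
  ... | false =
    ≤-reflexive (trans (countᵇ-map (covers p) (λ j → t + j * k) (upTo q)) (countᵇ-none _ (upTo q) missed))
    where
    missed : ∀ j → ¬ T (covers p (t + j * k))
    missed j hit = subst T eq (≡⇒≡ᵇ _ _ (begin
      t %′ period p                            ≡⟨ %′-+-*-∣ t j (period∣fibres adm) ⟨
      (t + j * k) %′ period p                  ≡⟨ %′-%′-∣ (t + j * k) (period∣modulus adm) ⟨
      (t + j * k) %′ modulus p %′ period p     ≡⟨ cong (_%′ period p) (≡ᵇ⇒≡ _ _ hit) ⟩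
      residue p                                ∎))
      where open ≡-Reasoning

  coveredIn-∷ : ∀ {p ps t} → Admissible k q p → t < k →
                coveredIn (p ∷ ps) t ≤ reach p (residue p) t + coveredIn ps t
  coveredIn-∷ {p} {ps} {t} adm t<k = ≤-trans
    (countᵇ-∨ (covers p) (λ x → any (λ p′ → covers p′ x) ps) (fibre k q t))
    (+-monoˡ-≤ (coveredIn ps t) (covered≤reach adm t<k))

  coveredIn-[] : ∀ t → coveredIn [] t ≡ 0
  coveredIn-[] t = countᵇ-none _ (fibre k q t) (λ _ ())

  coveredIn≤reach : ∀ {ps t} → All (Admissible k q) ps → t < k →
                    coveredIn ps t ≤ sum (map (λ p → reach p (residue p) t) ps)
  coveredIn≤reach {[]}    {t} []          _   = ≤-reflexive (coveredIn-[] t)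
  coveredIn≤reach {p ∷ ps}    (adm ∷ adms) t<k =
    ≤-trans (coveredIn-∷ {ps = ps} adm t<k) (+-monoʳ-≤ _ (coveredIn≤reach adms t<k))

  Dominated-lower : ∀ {p ps dem} → Admissible k q p → length dem ≡ k → Dominated (p ∷ ps) dem →
                    Dominated ps (lower p (residue p) dem)
  Dominated-lower {p} {ps} {dem} adm len dom t with t <? k
  ... | no  t≮k = ≤-trans (≤-reflexive (!-beyond (lower p (residue p) dem) beyond)) z≤n
    where
    beyond : length (lower p (residue p) dem) ≤ t
    beyond = subst (_≤ t) (sym (trans (length-lower p _ dem) len)) (≮⇒≥ t≮k)
  ... | yes t<k = begin
    lower p (residue p) dem ! t        ≡⟨ lower-! p (residue p) dem t ⟩
    dem ! t ∸ reach p (residue p) t    ≤⟨ m≤n+o⇒m∸n≤o (dem ! t) _ (≤-trans (dom t) (coveredIn-∷ {ps = ps} adm t<k)) ⟩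
    coveredIn ps t                     ∎
    where open ≤-Reasoning

  Dominated-replicate : ∀ {ps} → (∀ x → T (any (λ p → covers p x) ps)) → Dominated ps (replicate k q)
  Dominated-replicate {ps} covering t = ≤-trans (!-replicate≤ k q t) (≤-reflexive (sym (begin
    coveredIn ps t            ≡⟨ countᵇ-all _ (fibre k q t) covering ⟩
    length (fibre k q t)      ≡⟨ length-map _ (upTo q) ⟩
    length (upTo q)           ≡⟨ length-upTo q ⟩
    q                         ∎)))
    where open ≡-Reasoning

  hit⇒Any-covers : ∀ {ds x d} → d ∈ ds → x %′ d ≡ σ d → Any (λ p → T (covers p x)) (map (profileOf k q) ds)
  hit⇒Any-covers d∈ds hit = lose (∈-map⁺ (profileOf k q) d∈ds) (≡⇒≡ᵇ _ _ hit)

  residue<period : ∀ {p} → Admissible k q p → residue p < period p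
  residue<period adm = %′<period _ (period>0 adm)

  demand≤gains : ∀ {ps dem} → All (Admissible k q) ps → length dem ≡ k → Dominated ps dem →
                 sum dem ≤ sum (map (λ p → gains p dem ! residue p) ps)
  demand≤gains {ps} {dem} adms len dom = begin
    sum dem
      ≤⟨ sum≤sum-selectSum active capacity ps dem (λ t< → ≤-trans (dom _) (coveredIn≤reach adms (subst (_ <_) len t<))) ⟩
    sum (map (λ p → selectSum (active p) (map (_⊓ capacity p) dem)) ps)
      ≡⟨ cong sum (map-cong-local (All.map (λ {p} adm → sym (chunkSum-! (residue<period adm) (capped p))) adms)) ⟩
    sum (map (λ p → gains p dem ! residue p) ps) ∎
    where
    open ≤-Reasoning
    active = λ p t → t %′ period p ≡ᵇ residue p
    capped = λ p → map (_⊓ capacity p) dem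

  search-complete : ∀ {ps dem} → All (Admissible k q) ps → length dem ≡ k → Dominated ps dem → T (search ps dem)
  search-complete {[]} {dem} [] _ dom =
    ≡⇒≡ᵇ (sum dem) 0 (sum≡0 dem (λ t → ≤-trans (dom t) (≤-reflexive (coveredIn-[] t))))
  search-complete {p ∷ ps} {dem} (adm ∷ adms) len dom =
    Equivalence.from T-∨ (inj₂ (any⁺ _ (lose (∈-upTo⁺ (residue<period adm))
      (Equivalence.from T-∧ (≤⇒≤ᵇ fits , search-complete adms len′ (Dominated-lower {ps = ps} {dem} adm len dom))))))
    where
    len′ = trans (length-lower p _ dem) len
    fits : sum dem ≤ gains p dem ! residue p + potential ps dem
    fits = ≤-trans (demand≤gains {p ∷ ps} {dem} (adm ∷ adms) len dom)
                   (+-monoʳ-≤ (gains p dem ! residue p)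
                     (sum-map-mono (All.universal (λ p′ → !≤maximum (gains p′ dem) (residue p′)) ps)))

≡[mod]-trans : ∀ {d x y z} → x ≡ y [mod d ] → y ≡ z [mod d ] → x ≡ z [mod d ]
≡[mod]-trans {d} {x} {y} {z} x≡y y≡z =
  ℤ∣.∣⇒∣ᵤ (subst (ℤ.+ d ℤ∣.∣_) telescope
    (ℤ∣.∣m∣n⇒∣m+n {m = x -ℤ y} {n = y -ℤ z} (ℤ∣.∣ᵤ⇒∣ x≡y) (ℤ∣.∣ᵤ⇒∣ y≡z)))
  where
  open ℤ-Solver
  telescope : (x -ℤ y) +ℤ (y -ℤ z) ≡ x -ℤ z
  telescope = solve 3 (λ x y z → (x :- y) :+ (y :- z) := x :- z) refl x y z

≡[mod]-∣ : ∀ {d m x y} → d ∣ m → x ≡ y [mod m ] → x ≡ y [mod d ]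
≡[mod]-∣ = ∣-trans

≡[mod]-shift : ∀ {d} (x z y : ℤ) → (x +ℤ z) ≡ y [mod d ] → x ≡ (y -ℤ z) [mod d ]
≡[mod]-shift {d} x z y = subst (λ w → d ∣ ℤ.∣ w ∣) regroup
  where
  open ℤ-Solver
  regroup : (x +ℤ z) -ℤ y ≡ x -ℤ (y -ℤ z)
  regroup = solve 3 (λ x z y → (x :+ z) :- y := x :- (y :- z)) refl x z y

≡[mod]-%ℕ : ∀ {d} .{{_ : NonZero d}} x → x ≡ (ℤ.+ (x %ℕ d)) [mod d ]
≡[mod]-%ℕ {d} x = ℤ∣.∣⇒∣ᵤ (ℤ∣.divides (x /ℕ d) (begin
  x -ℤ ρ                           ≡⟨ cong (_-ℤ ρ) (a≡a%ℕn+[a/ℕn]*n x d) ⟩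
  ρ +ℤ (x /ℕ d) *ℤ ℤ.+ d -ℤ ρ      ≡⟨ solve 3 (λ ρ κ d → ρ :+ κ :* d :- ρ := κ :* d) refl ρ (x /ℕ d) (ℤ.+ d) ⟩
  (x /ℕ d) *ℤ ℤ.+ d                ∎))
  where
  open ≡-Reasoning
  open ℤ-Solver
  ρ = ℤ.+ (x %ℕ d)

≡[mod]-%′ : ∀ d x → (ℤ.+ x) ≡ (ℤ.+ (x %′ d)) [mod d ]
≡[mod]-%′ zero    x = subst (λ w → 0 ∣ ℤ.∣ w ∣) (sym (ℤ.+-inverseʳ (ℤ.+ x))) (0 ∣0)
≡[mod]-%′ (suc d) x = ≡[mod]-%ℕ (ℤ.+ x)

∣⊖∣≡∸ : ∀ {m n} → n ≤ m → ℤ.∣ m ⊖ n ∣ ≡ m ∸ n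
∣⊖∣≡∸ n≤m = cong ℤ.∣_∣ (ℤ.⊖-≥ n≤m)

≡[mod]⇒%′≡ : ∀ {d x s} → s < d → (ℤ.+ x) ≡ (ℤ.+ s) [mod d ] → x %′ d ≡ s
≡[mod]⇒%′≡ {suc d} {x} {s} s<d x≡s = from (≤-<-connex s x)
  where
  d∣x⊖s : suc d ∣ ℤ.∣ x ⊖ s ∣
  d∣x⊖s = subst (λ w → suc d ∣ ℤ.∣ w ∣) (ℤ.m-n≡m⊖n x s) x≡s
  from : s ≤ x ⊎ x < s → x % suc d ≡ s
  from (inj₁ s≤x) = begin
    x % suc d              ≡⟨ cong (_% suc d) (m+[n∸m]≡n s≤x) ⟨
    (s + (x ∸ s)) % suc d  ≡⟨ %-remove-+ʳ s (subst (suc d ∣_) (∣⊖∣≡∸ s≤x) d∣x⊖s) ⟩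
    s % suc d              ≡⟨ m<n⇒m%n≡m s<d ⟩
    s                      ∎
    where open ≡-Reasoning
  from (inj₂ x<s) = contradiction (∣⇒≤ {{>-nonZero (m<n⇒0<n∸m x<s)}} d∣s∸x) (<⇒≱ (≤-<-trans (m∸n≤m s x) s<d))
    where
    d∣s∸x : suc d ∣ s ∸ x
    d∣s∸x = subst (suc d ∣_) (trans (ℤ.∣m⊖n∣≡∣n⊖m∣ x s) (∣⊖∣≡∸ (<⇒≤ x<s))) d∣x⊖s

∈-divisorsFrom⁻ : ∀ {n m d} → d ∈ divisorsFrom n m → n ≤ d × d ∣ m
∈-divisorsFrom⁻ {n} {m} d∈ = proj₂ (∈-filter⁻ (modulus? n m) d∈)

∣⇒>0 : ∀ {d m} → 0 < m → d ∣ m → 0 < d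
∣⇒>0 {zero}  m>0 0∣m = contradiction (0∣⇒≡0 0∣m) (>⇒≢ m>0)
∣⇒>0 {suc d} _   _   = z<s

profilesOf-admissible : ∀ {k q n m ds} → 0 < m → (∀ {d} → d ∈ ds → d ∈ divisorsFrom n m) →
                        All (Admissible k q) (map (profileOf k q) ds)
profilesOf-admissible {n = n} m>0 ⊆divisors =
  map⁺ (All.tabulate (λ d∈ → profileOf-admissible (∣⇒>0 m>0 (proj₂ (∈-divisorsFrom⁻ {n} (⊆divisors d∈))))))

∣-irrelevant : ∀ {d m} (p p′ : suc d ∣ m) → p ≡ p′
∣-irrelevant {d} (divides q eq) (divides q′ eq′) with *-cancelʳ-≡ q q′ (suc d) (trans (sym eq) eq′)
... | refl = cong (divides q) (≡-irrelevant eq eq′)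

module Residues {n m} (m>0 : 0 < m) (r : ResidueChoice n m) (cov : Covers n m r) (z₀ : ℤ) where

  σ : ℕ → ℕ
  σ zero    = 0
  σ (suc d) with modulus? n m (suc d)
  ... | yes (n≤d , d∣m) = (r (suc d) d∣m n≤d -ℤ z₀) %ℕ suc d
  ... | no  _           = 0

  σ-spec : ∀ {d} (d∣m : suc d ∣ m) (n≤d : n ≤ suc d) → σ (suc d) ≡ (r (suc d) d∣m n≤d -ℤ z₀) %ℕ suc d
  σ-spec {d} d∣m n≤d with modulus? n m (suc d)
  ... | yes (n≤d′ , d∣m′) =
    cong (λ z → (z -ℤ z₀) %ℕ suc d) (cong₂ (r (suc d)) (∣-irrelevant d∣m′ d∣m) (≤-irrelevant n≤d′ n≤d))
  ... | no  ¬admissible  = contradiction (n≤d , d∣m) ¬admissible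

  σ≡0 : ∀ {d} (d∣m : d ∣ m) (n≤d : n ≤ d) → z₀ ≡ r d d∣m n≤d → σ d ≡ 0
  σ≡0 {zero}  _   _   _  = refl
  σ≡0 {suc d} d∣m n≤d eq = begin
    σ (suc d)                ≡⟨ σ-spec d∣m n≤d ⟩
    (ρ -ℤ z₀) %ℕ suc d       ≡⟨ cong (λ z → (ρ -ℤ z) %ℕ suc d) eq ⟩
    (ρ -ℤ ρ) %ℕ suc d        ≡⟨ cong (_%ℕ suc d) (ℤ.+-inverseʳ ρ) ⟩
    0                        ∎
    where
    open ≡-Reasoning
    ρ = r (suc d) d∣m n≤d

  covered : ∀ x → ∃[ d ] d ∈ divisorsFrom n m × x %′ d ≡ σ d
  covered x with cov (ℤ.+ x +ℤ z₀)
  ... | zero  , 0∣m , _   , _   = contradiction (0∣⇒≡0 0∣m) (>⇒≢ m>0)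
  ... | suc d , d∣m , n≤d , hit = suc d , d∈ , trans x%d≡ρ (sym (σ-spec d∣m n≤d))
    where
    ρ = r (suc d) d∣m n≤d -ℤ z₀
    d∈ : suc d ∈ divisorsFrom n m
    d∈ = ∈-filter⁺ (modulus? n m) (∈-upTo⁺ (s≤s (∣⇒≤ {{>-nonZero m>0}} d∣m))) (n≤d , d∣m)
    x≡ρ : (ℤ.+ x) ≡ (ℤ.+ (ρ %ℕ suc d)) [mod suc d ]
    x≡ρ = ≡[mod]-trans {x = ℤ.+ x} {y = ρ} (≡[mod]-shift (ℤ.+ x) z₀ _ hit) (≡[mod]-%ℕ ρ)
    x%d≡ρ : x %′ suc d ≡ ρ %ℕ suc d
    x%d≡ρ = ≡[mod]⇒%′≡ (n%ℕd<d ρ (suc d)) x≡ρ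

plainSearch-complete : ∀ {n m} k q → 0 < m → HasDivisorCovering n m → T (plainSearch n m k q)
plainSearch-complete {n} {m} k q m>0 (r , cov) =
  search-complete {profiles} (profilesOf-admissible {n = n} m>0 λ d∈ → d∈) (length-replicate k)
    (Dominated-replicate {profiles} covered-by-profiles)
  where
  open Residues m>0 r cov ℤ.0ℤ
  open Completeness k q σ
  profiles = map (profileOf k q) (divisorsFrom n m)
  covered-by-profiles : ∀ x → T (any (λ p → covers p x) profiles)
  covered-by-profiles x =
    let d , d∈ , hit = covered x in any⁺ (λ p → covers p x) (hit⇒Any-covers {divisorsFrom n m} d∈ hit)

pinnedSearch-complete : ∀ {n m d₀} k q → 0 < m → n ≤ d₀ → d₀ ∣ m → HasDivisorCovering n m →
                        T (pinnedSearch n m k q d₀)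
pinnedSearch-complete {n} {m} {d₀} k q m>0 n≤d₀ d₀∣m (r , cov) =
  search-complete {others} (profilesOf-admissible {n = n} m>0 (proj₁ ∘ ∈-filter⁻ ≢d₀?))
    (trans (length-lower p₀ 0 (replicate k q)) (length-replicate k))
    (subst (λ r₀ → Dominated others (lower p₀ r₀ (replicate k q))) pinned-residue
      (Dominated-lower {p₀} {others} {replicate k q} (profileOf-admissible (∣⇒>0 m>0 d₀∣m)) (length-replicate k)
        (Dominated-replicate {p₀ ∷ others} covered-by-profiles)))
  where
  open Residues m>0 r cov (r d₀ d₀∣m n≤d₀)
  open Completeness k q σ
  p₀ = profileOf k q d₀
  ≢d₀? = λ d → ¬? (d ≟ d₀)
  others = map (profileOf k q) (filter ≢d₀? (divisorsFrom n m))
  pinned-residue : residue p₀ ≡ 0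
  pinned-residue = trans (cong (_%′ period p₀) (σ≡0 d₀∣m n≤d₀ refl)) (0%′≡0 (period p₀))
  covered-by-profiles : ∀ x → T (any (λ p → covers p x) (p₀ ∷ others))
  covered-by-profiles x with covered x
  ... | d , d∈ , hit with d ≟ d₀
  ...   | yes refl = any⁺ {xs = p₀ ∷ others} (λ p → covers p x) (here (≡⇒≡ᵇ _ _ hit))
  ...   | no  d≢d₀ = any⁺ {xs = p₀ ∷ others} (λ p → covers p x)
                       (there (hit⇒Any-covers (∈-filter⁺ ≢d₀? d∈ d≢d₀) hit))

feasible-complete : ∀ {n m} s → 0 < m → HasDivisorCovering n m → T (feasible n m s)
feasible-complete {n} {m} (strategy k q nothing) m>0 covering = plainSearch-complete k q m>0 covering
feasible-complete {n} {m} (strategy k q (just d₀)) m>0 covering with modulus? n m d₀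
... | no  _             = tt
... | yes (n≤d₀ , d₀∣m) = pinnedSearch-complete k q m>0 n≤d₀ d₀∣m covering

coversPeriod : ℕ → ℕ → (ℕ → ℕ) → Bool
coversPeriod n m R = all (λ t → any (λ d → t %′ d ≡ᵇ R d) (divisorsFrom n m)) (upTo m)

coversPeriod-sound : ∀ {n m} R → 0 < m → T (coversPeriod n m R) → Covers n m (λ d _ _ → ℤ.+ R d)
coversPeriod-sound {n} {suc m} R _ check x
  with d , d∈ , hit ← find (any⁻ _ _ (All.lookup (all⁺ _ _ check) (∈-upTo⁺ (n%ℕd<d x (suc m)))))
  with n≤d , d∣m ← ∈-divisorsFrom⁻ {n} d∈
  = d , d∣m , n≤d ,
    ≡[mod]-trans {x = x} {y = ℤ.+ t} (≡[mod]-∣ {x = x} {y = ℤ.+ t} d∣m (≡[mod]-%ℕ x))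
      (subst (λ s → (ℤ.+ t) ≡ (ℤ.+ s) [mod d ]) (≡ᵇ⇒≡ (t %′ d) (R d) hit) (≡[mod]-%′ d t))
  where t = x %ℕ suc m

-- The covering for 360 and the search below 360

lookupOr : A → List (ℕ × A) → ℕ → A
lookupOr default []               key = default
lookupOr default ((k , a) ∷ kas) key = if key ≡ᵇ k then a else lookupOr default kas key

residue360 : ℕ → ℕ
residue360 = lookupOr 0
  ((4 , 0) ∷ (5 , 0) ∷ (6 , 1) ∷ (8 , 2) ∷ (9 , 0) ∷ (10 , 1) ∷ (12 , 5) ∷ (15 , 2) ∷ (18 , 3) ∷
   (20 , 3) ∷ (24 , 22) ∷ (30 , 29) ∷ (36 , 33) ∷ (40 , 6) ∷ (45 , 24) ∷ (60 , 14) ∷ (72 , 30) ∷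
   (90 , 87) ∷ (120 , 38) ∷ (180 , 42) ∷ (360 , 78) ∷ [])

-- With k = m and q = 1 every point is a fibre of its own and the search is plain backtracking
-- over the residues; the listed m need longer fibres to finish quickly.
strategyFor : ℕ → Strategy
strategyFor m = lookupOr (strategy m 1 nothing)
  ((120 , strategy 15 8 (just 5)) ∷ (168 , strategy 7 24 (just 4)) ∷ (180 , strategy 36 5 (just 4)) ∷
   (240 , strategy 48 5 (just 12)) ∷ (252 , strategy 7 36 (just 7)) ∷ (280 , strategy 7 40 (just 7)) ∷
   (288 , strategy 8 36 (just 4)) ∷ (300 , strategy 10 30 (just 5)) ∷ (336 , strategy 7 48 (just 7)) ∷ [])
  m

none-feasible-below-360 : any (λ m → feasible 4 m (strategyFor m)) (applyUpTo suc 359) ≡ false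
none-feasible-below-360 = refl

no-covering-below-360 : ∀ m → 0 < m → m < 360 → ¬ HasDivisorCovering 4 m
no-covering-below-360 (suc i) _ (s≤s i<359) covering =
  any≡false⇒¬T (λ m → feasible 4 m (strategyFor m)) {applyUpTo suc 359} none-feasible-below-360
    (∈-applyUpTo⁺ suc i<359) (feasible-complete (strategyFor (suc i)) z<s covering)

theorem4 : IsEll 4 360
theorem4 = z<s , ((λ d _ _ → ℤ.+ residue360 d) , coversPeriod-sound residue360 z<s tt) , no-covering-below-360
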